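{- Let $G$ be a finite unlabelled dag with root $u_0$ and let $T$ be a finite unlabelled tree with root $v_0$ of size $n$. If $u_0$ and $v_0$ are bisimilar, then $r(G\uplus T)\le 2\log_2(n)+2$.
   Context: A dag with root $u_0$ is a finite acyclic directed graph in which every node is reachable from $u_0$; an unlabelled tree is a finite rooted directed tree; $G\uplus T$ is the disjoint union. Two nodes are bisimilar if some relation $R$ containing them satisfies: for $(x,y)\in R$ every successor of $x$ is $R$-related to some successor of $y$ and vice versa. For $d\in\mathbb N$ write $u\xrightarrow{d}u'$ if there is a directed path of length $d$ from $u$ to $u'$. On a graph $H=(V,E)$ let $u\approx_0v$ for all $u,v$, and $u\approx_{k+1}v$ iff for all $d\in\mathbb N$, every $u\xrightarrow{d}u'$ has some $v\xrightarrow{d}v'$ with $u'\approx_kv'$ and every $v\xrightarrow{d}v'$ has some $u\xrightarrow{d}u'$ with $u'\approx_kv'$. Let $r(u,v)=\sup\{k\mid u\approx_kv\}\in\mathbb N\cup\{\infty\}$ and $r(H)=\sup\{r(u,v)\mid u,v\in V,\ u,v\text{ not bisimilar}\}\in\mathbb N\cup\{ -\infty\}$. -}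

module Defs where

open import Level using (0ℓ)
open import Data.Nat using (ℕ; zero; suc)
open import Data.Bool using (Bool; true; false)
open import Data.Fin using (Fin)
open import Data.Sum using (_⊎_; inj₁; inj₂)
open import Data.Product using (Σ; ∃; _×_; _,_)
open import Relation.Binary.PropositionalEquality using (_≡_)
open import Relation.Nullary using (¬_)

data Path {V : Set} (E : V → V → Bool) : ℕ → V → V → Set where
  here : ∀ {u} → Path E zero u u
  step : ∀ {d u w v} → E u w ≡ true → Path E d w v → Path E (suc d) u v

Acyclic : {V : Set} → (V → V → Bool) → Set
Acyclic {V} E = ∀ (u : V) (d : ℕ) → ¬ Path E (suc d) u u

AllReachable : {V : Set} → (V → V → Bool) → V → Set
AllReachable {V} E r = ∀ (u : V) → ∃ λ d → Path E d r u

IsRootedDag : ∀ {m} → (Fin m → Fin m → Bool) → Fin m → Set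
IsRootedDag E u0 = Acyclic E × AllReachable E u0

IsRootedTree : ∀ {n} → (Fin n → Fin n → Bool) → Fin n → Set
IsRootedTree {n} E v0 =
  AllReachable E v0
  × (∀ (p : Fin n) → ¬ (E p v0 ≡ true))
  × (∀ (v : Fin n) → ¬ (v ≡ v0) →
       (∃ λ p → E p v ≡ true)
       × (∀ p q → E p v ≡ true → E q v ≡ true → p ≡ q))

UnionEdge : ∀ {m n} → (Fin m → Fin m → Bool) → (Fin n → Fin n → Bool)
          → (Fin m ⊎ Fin n) → (Fin m ⊎ Fin n) → Bool
UnionEdge EG ET (inj₁ a) (inj₁ b) = EG a b
UnionEdge EG ET (inj₂ a) (inj₂ b) = ET a b
UnionEdge EG ET (inj₁ a) (inj₂ b) = false
UnionEdge EG ET (inj₂ a) (inj₁ b) = false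

IsBisimulation : {V : Set} → (V → V → Bool) → (V → V → Set) → Set
IsBisimulation {V} E R =
  ∀ (x y : V) → R x y →
    (∀ x' → E x x' ≡ true → ∃ λ y' → E y y' ≡ true × R x' y')
    × (∀ y' → E y y' ≡ true → ∃ λ x' → E x x' ≡ true × R x' y')

Bisimilar : {V : Set} → (V → V → Bool) → V → V → Set₁
Bisimilar {V} E x y = Σ (V → V → Set) λ R → IsBisimulation E R × R x y

Approx : {V : Set} → (V → V → Bool) → ℕ → V → V → Set
Approx E zero u v = Data.Unit.⊤
  where import Data.Unit
Approx {V} E (suc k) u v =
  (∀ (d : ℕ) (u' : V) → Path E d u u' → ∃ λ v' → Path E d v v' × Approx E k u' v')
  × (∀ (d : ℕ) (v' : V) → Path E d v v' → ∃ λ u' → Path E d u u' × Approx E k u' v')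

-- Every node of G is bisimilar to a node of T (follow its path from u₀ along
-- the bisimulation u₀ ∼ v₀), so it suffices to bound r(a, b) for tree nodes.
-- If a ≈_{k+2} b but a ≁ b, walking down along non-bisimilar pairs produces two
-- non-bisimilar nodes a', b' at the same depth below a with a' ≈_k b'.  In a
-- tree their descendant sets are disjoint, so by induction a has at least
-- 2^⌊k/2⌋ descendants; hence 2^⌊k/2⌋ ≤ n.  Bisimilarity is decided
-- classically, which is admissible because the conclusion is decidable.
module Submission where

open import Defs
open import Data.Bool using (Bool; true)
import Data.Bool as Bool
open import Data.Empty using (⊥; ⊥-elim)
open import Data.Fin as Fin using (Fin)
open import Data.Fin.Properties using (any?; injective⇒≤; join-splitAt)
open import Data.Nat using (ℕ; zero; suc; _+_; _*_; _^_; _∸_; _≤_; _<_; _≤?_; ⌊_/2⌋; z≤n; s≤s)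
open import Data.Nat.Properties
open import Data.Product using (∃; ∃₂; _×_; _,_; proj₁; proj₂)
open import Data.Sum using (_⊎_; inj₁; inj₂; [_,_]′)
open import Data.Unit using (tt)
open import Function using (_∘_; flip)
open import Function.Definitions using (Injective)
open import Level using (0ℓ; Setω)
open import Relation.Binary.PropositionalEquality using (_≡_; refl; sym; trans; cong; subst)
open import Relation.Nullary using (¬_; Dec; yes; no; ¬?)
open import Relation.Nullary.Decidable
  using (_×-dec_; decidable-stable; True; toWitness; fromWitness; ¬¬-excluded-middle)
open import Relation.Nullary.Negation using (¬¬-map)
open import Relation.Unary using (Pred; Decidable)

module _ {V : Set} {E : V → V → Bool} where

  _++ₚ_ : ∀ {a b u w z} → Path E a u w → Path E b w z → Path E (a + b) u z
  here       ++ₚ q = q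
  step e p   ++ₚ q = step e (p ++ₚ q)

  _∷ʳₚ_ : ∀ {d u w z} → Path E d u w → E w z ≡ true → Path E (suc d) u z
  here      ∷ʳₚ e = step e here
  step e' p ∷ʳₚ e = step e' (p ∷ʳₚ e)

  splitₚ : ∀ a {b u z} → Path E (a + b) u z → ∃ λ w → Path E a u w × Path E b w z
  splitₚ zero    p          = _ , here , p
  splitₚ (suc a) (step e p) = let (w , p₁ , p₂) = splitₚ a p in w , step e p₁ , p₂

Descendant : {V : Set} → (V → V → Bool) → V → Pred V 0ℓ
Descendant E t z = ∃ λ d → Path E d t z

descendant-prefix : ∀ {V : Set} {E : V → V → Bool} {d t t' z} →
                    Path E d t t' → Descendant E t' z → Descendant E t z
descendant-prefix p (e , q) = _ , p ++ₚ q

module Bisimulation {V : Set} (E : V → V → Bool) where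

  infix 4 _∼_
  _∼_ : V → V → Set₁
  _∼_ = Bisimilar E

  bisim-forth : ∀ {R} → IsBisimulation E R → ∀ {d u v u'} → R u v → Path E d u u' →
                ∃ λ v' → Path E d v v' × R u' v'
  bisim-forth isB r here = _ , here , r
  bisim-forth isB {u = u} {v} r (step {w = w} e p) =
    let (w' , e' , r')  = proj₁ (isB u v r) w e
        (v' , p' , r'') = bisim-forth isB r' p
    in v' , step e' p' , r''

  bisim-converse : ∀ {R} → IsBisimulation E R → IsBisimulation E (flip R)
  bisim-converse isB x y r = proj₂ (isB y x r) , proj₁ (isB y x r)

  bisim-back : ∀ {R} → IsBisimulation E R → ∀ {d u v v'} → R u v → Path E d v v' →
               ∃ λ u' → Path E d u u' × R u' v'
  bisim-back isB = bisim-forth (bisim-converse isB)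

  ∼-refl : ∀ u → u ∼ u
  ∼-refl u = _≡_ , (λ { x .x refl → (λ x' e → x' , e , refl) , (λ y' e → y' , e , refl) }) , refl

  ∼-sym : ∀ {u v} → u ∼ v → v ∼ u
  ∼-sym (R , isB , r) = flip R , bisim-converse isB , r

  ∼-trans : ∀ {u v w} → u ∼ v → v ∼ w → u ∼ w
  ∼-trans {u} {v} {w} (R , isR , r) (S , isS , s) = R∘S , isR∘S , (v , r , s)
    where
    R∘S : V → V → Set
    R∘S a c = ∃ λ b → R a b × S b c
    isR∘S : IsBisimulation E R∘S
    isR∘S x z (y , rxy , syz) =
      (λ x' e → let (y' , e' , r') = proj₁ (isR x y rxy) x' e
                    (z' , e'' , s') = proj₁ (isS y z syz) y' e'
                in z' , e'' , (y' , r' , s')) ,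
      (λ z' e → let (y' , e' , s') = proj₂ (isS y z syz) z' e
                    (x' , e'' , r') = proj₂ (isR x y rxy) y' e'
                in x' , e'' , (y' , r' , s'))

  ∼⇒approx : ∀ k {u v} → u ∼ v → Approx E k u v
  ∼⇒approx k (R , isB , r) = go k r
    where
    go : ∀ k {u v} → R u v → Approx E k u v
    go zero    r = tt
    go (suc k) r =
      (λ d u' p → let (v' , p' , r') = bisim-forth isB r p in v' , p' , go k r') ,
      (λ d v' p → let (u' , p' , r') = bisim-back  isB r p in u' , p' , go k r')

  approx-sym : ∀ k {u v} → Approx E k u v → Approx E k v u
  approx-sym zero    _ = tt
  approx-sym (suc k) (forth , back) =
    (λ d u' p → let (v' , p' , a) = back  d u' p in v' , p' , approx-sym k a) ,
    (λ d v' p → let (u' , p' , a) = forth d v' p in u' , p' , approx-sym k a)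

  approx-trans : ∀ k {u v w} → Approx E k u v → Approx E k v w → Approx E k u w
  approx-trans zero    _ _ = tt
  approx-trans (suc k) (forth₁ , back₁) (forth₂ , back₂) =
    (λ d u' p → let (v' , p' , a)  = forth₁ d u' p
                    (w' , p'' , b) = forth₂ d v' p'
                in w' , p'' , approx-trans k a b) ,
    (λ d w' p → let (v' , p' , b)  = back₂ d w' p
                    (u' , p'' , a) = back₁ d v' p'
                in u' , p'' , approx-trans k a b)

  approx-resp-∼ : ∀ k {u u' v v'} → u ∼ u' → v ∼ v' → Approx E k u v → Approx E k u' v'
  approx-resp-∼ k u∼u' v∼v' u≈v =
    approx-trans k (∼⇒approx k (∼-sym u∼u')) (approx-trans k u≈v (∼⇒approx k v∼v'))

  approx-≤ : ∀ {j k u v} → j ≤ k → Approx E k u v → Approx E j u v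
  approx-≤ z≤n       _ = tt
  approx-≤ (s≤s j≤k) (forth , back) =
    (λ d u' p → let (v' , p' , a) = forth d u' p in v' , p' , approx-≤ j≤k a) ,
    (λ d v' p → let (u' , p' , a) = back  d v' p in u' , p' , approx-≤ j≤k a)

Searchable : Set → Setω
Searchable V = ∀ {ℓ} {P : Pred V ℓ} → Decidable P → Dec (∃ P)

module DecidableBisimilarity {V : Set} (E : V → V → Bool) (search : Searchable V)
                             (∼? : ∀ u v → Dec (Bisimilar E u v)) where
  open Bisimulation E

  successor? : ∀ {ℓ} {P : Pred V ℓ} → Decidable P → ∀ u → Dec (∃ λ u' → E u u' ≡ true × P u')
  successor? P? u = search (λ u' → (E u u' Bool.≟ true) ×-dec P? u')

  ∼-by-successors : ∀ {p q} →
    (∀ p' → E p p' ≡ true → ∃ λ q' → E q q' ≡ true × p' ∼ q') →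
    (∀ q' → E q q' ≡ true → ∃ λ p' → E p p' ≡ true × p' ∼ q') → p ∼ q
  ∼-by-successors {p} {q} forth back = R , isR , inj₁ (refl , refl)
    where
    -- True (∼? a b) is a small copy of the large type a ∼ b.
    R : V → V → Set
    R a b = (a ≡ p × b ≡ q) ⊎ True (∼? a b)
    isR : IsBisimulation E R
    isR .p .q (inj₁ (refl , refl)) =
      (λ p' e → let (q' , e' , s) = forth p' e in q' , e' , inj₂ (fromWitness s)) ,
      (λ q' e → let (p' , e' , s) = back q' e in p' , e' , inj₂ (fromWitness s))
    isR x y (inj₂ x∼y) with S , isS , s ← toWitness x∼y =
      (λ x' e → let (y' , e' , s') = proj₁ (isS x y s) x' e in y' , e' , inj₂ (fromWitness (S , isS , s'))) ,
      (λ y' e → let (x' , e' , s') = proj₂ (isS x y s) y' e in x' , e' , inj₂ (fromWitness (S , isS , s')))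

  ≁-successors : ∀ k {p q} → Approx E (suc k) p q → ¬ p ∼ q →
    ∃₂ λ p' q' → E p p' ≡ true × E q q' ≡ true × Approx E k p' q' × ¬ p' ∼ q'
  ≁-successors k {p} {q} (forth , back) p≁q
    with search (λ p' → (E p p' Bool.≟ true) ×-dec ¬? (successor? (∼? p') q))
  ... | yes (p' , pp' , unmatched) with forth 1 p' (step pp' here)
  ...   | q' , step qq' here , p'≈q' =
          p' , q' , pp' , qq' , p'≈q' , λ p'∼q' → unmatched (q' , qq' , p'∼q')
  ≁-successors k {p} {q} (forth , back) p≁q | no p-matched
    with search (λ q' → (E q q' Bool.≟ true) ×-dec ¬? (successor? (λ p' → ∼? p' q') p))
  ... | yes (q' , qq' , unmatched) with back 1 q' (step qq' here)
  ...   | p' , step pp' here , p'≈q' =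
          p' , q' , pp' , qq' , p'≈q' , λ p'∼q' → unmatched (p' , pp' , p'∼q')
  ≁-successors k {p} {q} (forth , back) p≁q | no p-matched | no q-matched =
    ⊥-elim (p≁q (∼-by-successors
      (λ p' pp' → decidable-stable (successor? (∼? p') q) (λ u → p-matched (p' , pp' , u)))
      (λ q' qq' → decidable-stable (successor? (λ p' → ∼? p' q') p) (λ u → q-matched (q' , qq' , u)))))

  ApproxTwins : ℕ → V → Set₁
  ApproxTwins k X = ∃ λ D → ∃₂ λ a b → Path E D X a × Path E D X b × ¬ a ∼ b × Approx E k a b

  approx-twins : ∀ {N k X Y} → (∀ {d z} → Path E d X z → d < N) →
                 Approx E (suc (suc k)) X Y → ¬ X ∼ Y → ApproxTwins k X
  approx-twins {N} {k} {X} {Y} bounded X≈Y X≁Y =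
    descend N (+-identityʳ N) here here (approx-≤ (n≤1+n (suc k)) X≈Y) X≁Y
    where
    -- q' is matched below X by some p″ ≈_{k+1} q'.  Either p″ ∼ q', and then p'
    -- and p″ are the twins, or the walk continues from (p″ , q'); the depth
    -- bound N stops it before the fuel runs out.
    descend : ∀ fuel {d p q} → fuel + d ≡ N → Path E d X p → Path E d Y q →
              Approx E (suc k) p q → ¬ p ∼ q → ApproxTwins k X
    descend zero       refl Xp _ _ _ = ⊥-elim (<-irrefl refl (bounded Xp))
    descend (suc fuel) {d} eq Xp Yq p≈q p≁q
      with p' , q' , pp' , qq' , p'≈q' , p'≁q' ← ≁-successors k p≈q p≁q
      with p″ , Xp″ , p″≈q' ← proj₂ X≈Y (suc d) q' (Yq ∷ʳₚ qq')
      with ∼? p″ q'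
    ... | yes p″∼q' =
          suc d , p' , p″ , Xp ∷ʳₚ pp' , Xp″ , (λ p'∼p″ → p'≁q' (∼-trans p'∼p″ p″∼q')) ,
          approx-resp-∼ k (∼-refl p') (∼-sym p″∼q') p'≈q'
    ... | no p″≁q' = descend fuel (trans (+-suc fuel d) eq) Xp″ (Yq ∷ʳₚ qq') p″≈q' p″≁q'

record AtLeast {n : ℕ} (P : Pred (Fin n) 0ℓ) (a : ℕ) : Set where
  field
    elem           : Fin a → Fin n
    elem-injective : Injective _≡_ _≡_ elem
    elem-satisfies : ∀ i → P (elem i)

module _ {n : ℕ} where
  open AtLeast

  atLeast-one : ∀ {P : Pred (Fin n) 0ℓ} {z} → P z → AtLeast P 1
  elem           (atLeast-one {z = z} _) _ = z
  elem-injective (atLeast-one _) {Fin.zero} {Fin.zero} _ = refl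
  elem-satisfies (atLeast-one pz) _ = pz

  atLeast-mono : ∀ {P Q : Pred (Fin n) 0ℓ} {a} → (∀ {z} → P z → Q z) → AtLeast P a → AtLeast Q a
  elem           (atLeast-mono P⇒Q I) = elem I
  elem-injective (atLeast-mono P⇒Q I) = elem-injective I
  elem-satisfies (atLeast-mono P⇒Q I) i = P⇒Q (elem-satisfies I i)

  atLeast⇒≤ : ∀ {P : Pred (Fin n) 0ℓ} {a} → AtLeast P a → a ≤ n
  atLeast⇒≤ I = injective⇒≤ (elem-injective I)

  atLeast-+ : ∀ {P Q : Pred (Fin n) 0ℓ} {a b} → AtLeast P a → AtLeast Q b →
              (∀ {z} → P z → Q z → ⊥) → AtLeast (λ z → P z ⊎ Q z) (a + b)
  atLeast-+ {P} {Q} {a} {b} I J disjoint = record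
    { elem           = joint ∘ Fin.splitAt a
    ; elem-injective = splitAt-injective ∘ joint-injective
    ; elem-satisfies = joint-satisfies ∘ Fin.splitAt a
    }
    where
    joint : Fin a ⊎ Fin b → Fin n
    joint = [ elem I , elem J ]′

    joint-satisfies : ∀ s → P (joint s) ⊎ Q (joint s)
    joint-satisfies (inj₁ i) = inj₁ (elem-satisfies I i)
    joint-satisfies (inj₂ j) = inj₂ (elem-satisfies J j)

    joint-injective : Injective _≡_ _≡_ joint
    joint-injective {inj₁ i} {inj₁ j} e = cong inj₁ (elem-injective I e)
    joint-injective {inj₂ i} {inj₂ j} e = cong inj₂ (elem-injective J e)
    joint-injective {inj₁ i} {inj₂ j} e = ⊥-elim (disjoint (elem-satisfies I i) (subst Q (sym e) (elem-satisfies J j)))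
    joint-injective {inj₂ i} {inj₁ j} e = ⊥-elim (disjoint (elem-satisfies I j) (subst Q e (elem-satisfies J i)))

    splitAt-injective : Injective _≡_ _≡_ (Fin.splitAt a {b})
    splitAt-injective {i} {j} e =
      trans (sym (join-splitAt a b i)) (trans (cong (Fin.join a b) e) (join-splitAt a b j))

module RootedTree {n : ℕ} (E : Fin n → Fin n → Bool) (root : Fin n) (tree : IsRootedTree E root) where

  private
    reachable : AllReachable E root
    reachable = proj₁ tree

    root-orphan : ∀ p → ¬ E p root ≡ true
    root-orphan = proj₁ (proj₂ tree)

    parent-unique : ∀ v → ¬ v ≡ root → ∀ p q → E p v ≡ true → E q v ≡ true → p ≡ q
    parent-unique v v≢root = proj₂ (proj₂ (proj₂ tree) v v≢root)

  source-unique : ∀ d {a c z} → Path E d a z → Path E d c z → a ≡ c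
  source-unique zero    here here = refl
  source-unique (suc d) (step {w = a'} aa' p) (step cc' q) with source-unique d p q
  ... | refl with a' Fin.≟ root
  ...   | yes refl   = ⊥-elim (root-orphan _ aa')
  ...   | no a'≢root = parent-unique a' a'≢root _ _ aa' cc'

  prefix-reaches : ∀ s {L u w z} → Path E (s + L) u z → Path E L w z → Path E s u w
  prefix-reaches s {L} p q =
    let (_ , p₁ , p₂) = splitₚ s p in subst (Path E s _) (source-unique L p₂ q) p₁

  ¬path-into-root : ∀ {d u} → ¬ Path E (suc d) u root
  ¬path-into-root (step e here)          = root-orphan _ e
  ¬path-into-root (step _ p@(step _ _))  = ¬path-into-root p

  root-loop-trivial : ∀ l → Path E l root root → l ≡ 0
  root-loop-trivial zero    _    = refl
  root-loop-trivial (suc l) loop = ⊥-elim (¬path-into-root loop)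

  root-depth-≤-unique : ∀ {d e z} → d ≤ e → Path E d root z → Path E e root z → d ≡ e
  root-depth-≤-unique {d} {e} d≤e p q = ≤-antisym d≤e (m∸n≡0⇒m≤n (root-loop-trivial (e ∸ d)
    (prefix-reaches (e ∸ d) (subst (λ l → Path E l root _) (sym (m∸n+n≡m d≤e)) q) p)))

  root-depth-unique : ∀ {d e z} → Path E d root z → Path E e root z → d ≡ e
  root-depth-unique {d} {e} p q with ≤-total d e
  ... | inj₁ d≤e = root-depth-≤-unique d≤e p q
  ... | inj₂ e≤d = sym (root-depth-≤-unique e≤d q p)

  acyclic : Acyclic E
  acyclic u d loop =
    let (r , root→u) = reachable u in m+1+n≢m r (root-depth-unique (root→u ++ₚ loop) root→u)

  same-depth-common-descendant⇒≡ : ∀ {D X a b z} → Path E D X a → Path E D X b →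
                                   Descendant E a z → Descendant E b z → a ≡ b
  same-depth-common-descendant⇒≡ {D} {X} {b = b} {z} Xa Xb (e , az) (e' , bz) =
    source-unique e az (subst (λ l → Path E l b z) (sym e≡e') bz)
    where
    r : ℕ
    r = proj₁ (reachable X)
    root→X : Path E r root X
    root→X = proj₂ (reachable X)
    e≡e' : e ≡ e'
    e≡e' = +-cancelˡ-≡ (r + D) e e'
      (root-depth-unique ((root→X ++ₚ Xa) ++ₚ az) ((root→X ++ₚ Xb) ++ₚ bz))

  path-nodes : ∀ {d t z} → Path E d t z → AtLeast (Descendant E t) (suc d)
  path-nodes here       = atLeast-one (0 , here)
  path-nodes {t = t} (step tt' p) =
    atLeast-mono (λ { (inj₁ refl) → 0 , here ; (inj₂ t'→z) → descendant-prefix (step tt' here) t'→z })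
      (atLeast-+ (atLeast-one {P = _≡ t} refl) (path-nodes p)
                 (λ { refl (l , t'→t) → acyclic t l (step tt' t'→t) }))

  path-length< : ∀ {d t z} → Path E d t z → d < n
  path-length< p = atLeast⇒≤ (path-nodes p)

search-Fin⊎Fin : ∀ {m n} → Searchable (Fin m ⊎ Fin n)
search-Fin⊎Fin P? with any? (P? ∘ inj₁) | any? (P? ∘ inj₂)
... | yes (i , p) | _           = yes (inj₁ i , p)
... | no _        | yes (j , p) = yes (inj₂ j , p)
... | no ¬left    | no ¬right   = no λ { (inj₁ i , p) → ¬left (i , p) ; (inj₂ j , p) → ¬right (j , p) }

¬¬-∀-Fin : ∀ {ℓ} N {P : Fin N → Set ℓ} → (∀ i → ¬ ¬ P i) → ¬ ¬ (∀ i → P i)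
¬¬-∀-Fin zero    _    k = k (λ ())
¬¬-∀-Fin (suc N) ¬¬P k = ¬¬P Fin.zero λ p₀ → ¬¬-∀-Fin N (¬¬P ∘ Fin.suc)
  λ ps → k λ { Fin.zero → p₀ ; (Fin.suc i) → ps i }

¬¬-∀-Fin⊎Fin : ∀ {ℓ} m n {P : Fin m ⊎ Fin n → Set ℓ} → (∀ v → ¬ ¬ P v) → ¬ ¬ (∀ v → P v)
¬¬-∀-Fin⊎Fin m n ¬¬P k = ¬¬-∀-Fin m (¬¬P ∘ inj₁) λ left → ¬¬-∀-Fin n (¬¬P ∘ inj₂)
  λ right → k λ { (inj₁ i) → left i ; (inj₂ j) → right j }

module DagTreeUnion (m n : ℕ)
  (EG : Fin m → Fin m → Bool) (u0 : Fin m) (reachable : AllReachable EG u0)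
  (ET : Fin n → Fin n → Bool) (v0 : Fin n) (tree : IsRootedTree ET v0)
  (u0∼v0 : Bisimilar (UnionEdge EG ET) (inj₁ u0) (inj₂ v0)) where

  open Bisimulation (UnionEdge EG ET)
  open RootedTree ET v0 tree

  tree-path : ∀ {d t z} → Path (UnionEdge EG ET) d (inj₂ t) z →
              ∃ λ t' → z ≡ inj₂ t' × Path ET d t t'
  tree-path here                  = _ , refl , here
  tree-path (step {w = inj₂ w} e p) with t' , refl , q ← tree-path p = t' , refl , step e q

  tree-path-length< : ∀ {d t z} → Path (UnionEdge EG ET) d (inj₂ t) z → d < n
  tree-path-length< p with _ , refl , q ← tree-path p = path-length< q

  dag-path : ∀ {d a b} → Path EG d a b → Path (UnionEdge EG ET) d (inj₁ a) (inj₁ b)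
  dag-path here       = here
  dag-path (step e p) = step e (dag-path p)

  ∼-tree-node : ∀ z → ∃ λ t → z ∼ inj₂ t
  ∼-tree-node (inj₂ t) = t , ∼-refl _
  ∼-tree-node (inj₁ g) =
    let (R , isR , r)    = u0∼v0
        (_ , u0→g)       = reachable g
        (_ , v0→z , g∼z) = bisim-forth isR r (dag-path u0→g)
        (t , z≡t , _)    = tree-path v0→z
    in t , R , isR , subst (R (inj₁ g)) z≡t g∼z

  module _ (∼? : ∀ u v → Dec (u ∼ v)) where
    open DecidableBisimilarity (UnionEdge EG ET) search-Fin⊎Fin ∼?

    descendant-count : ∀ k {a b} → ¬ inj₂ a ∼ inj₂ b → Approx (UnionEdge EG ET) k (inj₂ a) (inj₂ b) →
                       AtLeast (Descendant ET a) (2 ^ ⌊ k /2⌋)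
    descendant-count zero          _ _ = atLeast-one (0 , here)
    descendant-count (suc zero)    _ _ = atLeast-one (0 , here)
    descendant-count (suc (suc k)) {a} a≁b a≈b
      with D , _ , _ , a→a' , a→b' , a'≁b' , a'≈b' ← approx-twins tree-path-length< a≈b a≁b
      with a' , refl , a→a'ᵀ ← tree-path a→a'
      with b' , refl , a→b'ᵀ ← tree-path a→b' =
      subst (AtLeast (Descendant ET a)) (cong (2 ^ ⌊ k /2⌋ +_) (sym (+-identityʳ _)))
        (atLeast-mono [ descendant-prefix a→a'ᵀ , descendant-prefix a→b'ᵀ ]′
          (atLeast-+ (descendant-count k a'≁b' a'≈b')
                     (descendant-count k (a'≁b' ∘ ∼-sym) (approx-sym k a'≈b'))
                     λ a'→z b'→z → a'≁b' (subst (λ w → inj₂ a' ∼ inj₂ w)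
                       (same-depth-common-descendant⇒≡ a→a'ᵀ a→b'ᵀ a'→z b'→z) (∼-refl _))))

    ≁⇒2^⌊k/2⌋≤n : ∀ x y → ¬ x ∼ y → ∀ k → Approx (UnionEdge EG ET) k x y → 2 ^ ⌊ k /2⌋ ≤ n
    ≁⇒2^⌊k/2⌋≤n x y x≁y k x≈y =
      let (t , x∼t) = ∼-tree-node x
          (s , y∼s) = ∼-tree-node y
      in atLeast⇒≤ (descendant-count k (λ t∼s → x≁y (∼-trans x∼t (∼-trans t∼s (∼-sym y∼s))))
                                       (approx-resp-∼ k x∼t y∼s x≈y))

n≤1+⌊n/2⌋+⌊n/2⌋ : ∀ n → n ≤ suc (⌊ n /2⌋ + ⌊ n /2⌋)
n≤1+⌊n/2⌋+⌊n/2⌋ zero          = z≤n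
n≤1+⌊n/2⌋+⌊n/2⌋ (suc zero)    = s≤s z≤n
n≤1+⌊n/2⌋+⌊n/2⌋ (suc (suc n)) =
  s≤s (s≤s (≤-trans (n≤1+⌊n/2⌋+⌊n/2⌋ n) (≤-reflexive (sym (+-suc ⌊ n /2⌋ ⌊ n /2⌋)))))

2^⌊k/2⌋≤n⇒2^[k∸2]≤n*n : ∀ k {n} → 2 ^ ⌊ k /2⌋ ≤ n → 2 ^ (k ∸ 2) ≤ n * n
2^⌊k/2⌋≤n⇒2^[k∸2]≤n*n k {n} bound = begin
  2 ^ (k ∸ 2)    ≤⟨ ^-monoʳ-≤ 2 k∸2≤h+h ⟩
  2 ^ (h + h)    ≡⟨ ^-distribˡ-+-* 2 h h ⟩
  2 ^ h * 2 ^ h  ≤⟨ *-mono-≤ bound bound ⟩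
  n * n          ∎
  where
  open ≤-Reasoning
  h : ℕ
  h = ⌊ k /2⌋
  k∸2≤h+h : k ∸ 2 ≤ h + h
  k∸2≤h+h = ≤-trans (∸-monoʳ-≤ k (s≤s z≤n)) (∸-monoˡ-≤ 1 (n≤1+⌊n/2⌋+⌊n/2⌋ k))

lemma3p11 : ∀ (m n : ℕ)
    (EG : Fin m → Fin m → Bool) (u0 : Fin m) → IsRootedDag EG u0 →
    (ET : Fin n → Fin n → Bool) (v0 : Fin n) → IsRootedTree ET v0 →
    Bisimilar (UnionEdge EG ET) (inj₁ u0) (inj₂ v0) →
    ∀ x y → ¬ Bisimilar (UnionEdge EG ET) x y →
    ∀ (k : ℕ) → Approx (UnionEdge EG ET) k x y →
    2 ^ (k ∸ 2) ≤ n * n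
lemma3p11 m n EG u0 (_ , reachable) ET v0 tree u0∼v0 x y x≁y k x≈y =
  decidable-stable (2 ^ (k ∸ 2) ≤? n * n) (¬¬-map bound ¬¬-∼-decidable)
  where
  open DagTreeUnion m n EG u0 reachable ET v0 tree u0∼v0
  bound : (∀ u v → Dec (Bisimilar (UnionEdge EG ET) u v)) → 2 ^ (k ∸ 2) ≤ n * n
  bound ∼? = 2^⌊k/2⌋≤n⇒2^[k∸2]≤n*n k (≁⇒2^⌊k/2⌋≤n ∼? x y x≁y k x≈y)
  ¬¬-∼-decidable : ¬ ¬ (∀ u v → Dec (Bisimilar (UnionEdge EG ET) u v))
  ¬¬-∼-decidable = ¬¬-∀-Fin⊎Fin m n λ u → ¬¬-∀-Fin⊎Fin m n λ v → ¬¬-excluded-middle
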